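{- For every typing context $\Gamma$, term $t$ and type $T$ of the $\lambda\Delta$-calculus: if $\Gamma \vdash t : T$, then there exists a term $n$ such that $t \to^{!} n$, i.e. $t \to^* n$ and $n$ is a normal form.
   Context: The $\lambda\Delta$-calculus. Types: $T ::= \perp \mid b \mid A \to B$, where $b$ ranges over base types and $\perp$ is absurdity; $\neg A$ abbreviates $A \to \perp$. Terms: $t ::= x \mid \lambda x{:}T.\,t \mid \Delta x{:}T.\,t \mid t_1\, t_2$, where $\lambda$ and $\Delta$ bind $x$; terms are taken up to renaming of bound variables. Normal forms: $n, m ::= x \mid \lambda x{:}T.\,n \mid \Delta x{:}T.\,n \mid h\, n$, with heads $h ::= x \mid h\, n$. Contexts $\Gamma$ are finite lists of assumptions $x{:}A$ with pairwise distinct variables (order irrelevant). Typing rules: (Ax) if $x{:}T \in \Gamma$ then $\Gamma \vdash x : T$; (Lam) if $\Gamma, x{:}A \vdash t : B$ then $\Gamma \vdash \lambda x{:}A.\,t : A \to B$; (App) if $\Gamma \vdash t_1 : A \to B$ and $\Gamma \vdash t_2 : A$ then $\Gamma \vdash t_1\, t_2 : B$; (Delta) if $\Gamma, x{:}\neg A \vdash t : \perp$ then $\Gamma \vdash \Delta x{:}\neg A.\,t : A$. Reduction $\to$ is the compatible closure of ($\beta$) $(\lambda x{:}A.\,t)\, t' \to [t'/x]t$ and (structural) $(\Delta x{:}\neg(A\to B).\,t)\, t' \to \Delta z{:}\neg B.\,[\lambda y{:}A\to B.\,(z\,(y\,t'))/x]\,t$ with $z, y$ fresh, where $[t'/x]t$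 denotes capture-avoiding substitution. $\to^*$ is the reflexive transitive closure of $\to$, and $t \to^{!} t'$ means $t \to^* t'$ with $t'$ a normal form. -}

module Defs where

open import Data.Nat using (ℕ; zero; suc)
open import Data.List using (List; _∷_)
open import Data.List.Membership.Propositional using (_∈_)
open import Data.Product using (∃; _×_)
open import Relation.Binary.Construct.Closure.ReflexiveTransitive using (Star)

data Type : Set where
  ⊥'   : Type
  base : ℕ → Type
  _⇒_  : Type → Type → Type

infixr 7 _⇒_

¬' : Type → Type
¬' A = A ⇒ ⊥'

-- Terms in de Bruijn notation (so terms are identified up to α-renaming).
-- var i refers to the i-th enclosing binder (λ or Δ), or to the context.
data Term : Set where
  var   : ℕ → Term
  lam   : Type → Term → Term
  delta : Type → Term → Term
  app   : Term → Term → Term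

data Normal : Term → Set
data Head   : Term → Set

data Normal where
  nvar   : ∀ x → Normal (var x)
  nlam   : ∀ T {n} → Normal n → Normal (lam T n)
  ndelta : ∀ T {n} → Normal n → Normal (delta T n)
  napp   : ∀ {h n} → Head h → Normal n → Normal (app h n)

data Head where
  hvar : ∀ x → Head (var x)
  happ : ∀ {h n} → Head h → Normal n → Head (app h n)

Context : Set
Context = List Type

data _∋_∶_ : Context → ℕ → Type → Set where
  here  : ∀ {Γ A} → (A ∷ Γ) ∋ zero ∶ A
  there : ∀ {Γ A B x} → Γ ∋ x ∶ A → (B ∷ Γ) ∋ suc x ∶ A

data _⊢_∶_ : Context → Term → Type → Set where
  ax    : ∀ {Γ x T} → Γ ∋ x ∶ T → Γ ⊢ var x ∶ T
  ⊢lam  : ∀ {Γ A B t} → (A ∷ Γ) ⊢ t ∶ B → Γ ⊢ lam A t ∶ (A ⇒ B)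
  ⊢app  : ∀ {Γ A B t₁ t₂} → Γ ⊢ t₁ ∶ (A ⇒ B) → Γ ⊢ t₂ ∶ A → Γ ⊢ app t₁ t₂ ∶ B
  ⊢delta : ∀ {Γ A t} → (¬' A ∷ Γ) ⊢ t ∶ ⊥' → Γ ⊢ delta (¬' A) t ∶ A

ext : (ℕ → ℕ) → ℕ → ℕ
ext ρ zero    = zero
ext ρ (suc i) = suc (ρ i)

rename : (ℕ → ℕ) → Term → Term
rename ρ (var x)     = var (ρ x)
rename ρ (lam T t)   = lam T (rename (ext ρ) t)
rename ρ (delta T t) = delta T (rename (ext ρ) t)
rename ρ (app t u)   = app (rename ρ t) (rename ρ u)

exts : (ℕ → Term) → ℕ → Term
exts σ zero    = var zero
exts σ (suc i) = rename suc (σ i)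

subst : (ℕ → Term) → Term → Term
subst σ (var x)     = σ x
subst σ (lam T t)   = lam T (subst (exts σ) t)
subst σ (delta T t) = delta T (subst (exts σ) t)
subst σ (app t u)   = app (subst σ t) (subst σ u)

-- [s/x]t where x is var 0 of t: free variables above 0 are decremented.
single : Term → ℕ → Term
single s zero    = s
single s (suc i) = var i

_[_] : Term → Term → Term
t [ s ] = subst (single s) t

-- Replace var 0 by s, keeping the other indices (used when the binder x
-- is replaced by a new binder z in the structural rule).
replace0 : Term → ℕ → Term
replace0 s zero    = s
replace0 s (suc i) = var (suc i)

-- Structural rule: (Δx:¬(A→B). t) t' → Δz:¬B. [λy:A→B. z (y t') / x] t.
-- Under Δz, z is var 0; inside λy, y is var 0 and z is var 1, and t'
-- is shifted past the two new binders.
data _⟶_ : Term → Term → Set where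
  β      : ∀ {A t t'} → app (lam A t) t' ⟶ (t [ t' ])
  struct : ∀ {A B t t'} →
           app (delta (¬' (A ⇒ B)) t) t' ⟶
           delta (¬' B)
             (subst (replace0 (lam (A ⇒ B)
                       (app (var 1) (app (var 0) (rename (λ i → suc (suc i)) t')))))
                    t)
  ξlam   : ∀ {T t t'} → t ⟶ t' → lam T t ⟶ lam T t'
  ξdelta : ∀ {T t t'} → t ⟶ t' → delta T t ⟶ delta T t'
  ξappₗ  : ∀ {t t' u} → t ⟶ t' → app t u ⟶ app t' u
  ξappᵣ  : ∀ {t u u'} → u ⟶ u' → app t u ⟶ app t u'

_⟶*_ : Term → Term → Set
_⟶*_ = Star _⟶_

_⟶!_ : Term → Term → Set
t ⟶! n = (t ⟶* n) × Normal n

module Submission where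

-- A term is reducible at A (Red A) when it is weakly normalising and, at an
-- arrow type A ⇒ B, every renaming of it applied to a term reducible at A is
-- reducible at B.  The binders are handled by Red-lam (via
-- β) and Red-Δ, the heart of the argument: at an arrow type the structural
-- rule rewrites (Δx.t) u to Δz.[λy. z (y u)/x]t, and the continuation
-- λy. k (y u) is reducible at ¬(A ⇒ B) whenever k is reducible at ¬B
-- (Red-cont), so induction on the type goes through.  The fundamental lemma
-- (typed terms under reducible substitutions are reducible), instantiated at
-- the identity substitution, yields the theorem.

open import Defs
open import Data.Nat using (ℕ; zero; suc)
open import Data.List using (_∷_)
open import Data.Product using (∃; _×_; _,_; proj₁)
open import Function using (_∘_)
open import Relation.Binary.PropositionalEquality
  using (_≡_; refl; sym; trans; cong; cong₂; module ≡-Reasoning)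
  renaming (subst to transport)
open import Relation.Binary.Construct.Closure.ReflexiveTransitive
  using (ε; _◅◅_; gmap; return)

_∷ₛ_ : Term → (ℕ → Term) → ℕ → Term
(u ∷ₛ σ) zero    = u
(u ∷ₛ σ) (suc i) = σ i

inst : (ℕ → ℕ) → Term → ℕ → Term
inst ρ u = u ∷ₛ (var ∘ ρ)

ext-cong : ∀ {ρ ρ' : ℕ → ℕ} → (∀ i → ρ i ≡ ρ' i) → ∀ i → ext ρ i ≡ ext ρ' i
ext-cong e zero    = refl
ext-cong e (suc i) = cong suc (e i)

rename-cong : ∀ {ρ ρ' : ℕ → ℕ} → (∀ i → ρ i ≡ ρ' i) → ∀ t → rename ρ t ≡ rename ρ' t
rename-cong e (var x)     = cong var (e x)
rename-cong e (lam T t)   = cong (lam T) (rename-cong (ext-cong e) t)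
rename-cong e (delta T t) = cong (delta T) (rename-cong (ext-cong e) t)
rename-cong e (app t u)   = cong₂ app (rename-cong e t) (rename-cong e u)

exts-cong : ∀ {σ τ : ℕ → Term} → (∀ i → σ i ≡ τ i) → ∀ i → exts σ i ≡ exts τ i
exts-cong e zero    = refl
exts-cong e (suc i) = cong (rename suc) (e i)

subst-cong : ∀ {σ τ : ℕ → Term} → (∀ i → σ i ≡ τ i) → ∀ t → subst σ t ≡ subst τ t
subst-cong e (var x)     = e x
subst-cong e (lam T t)   = cong (lam T) (subst-cong (exts-cong e) t)
subst-cong e (delta T t) = cong (delta T) (subst-cong (exts-cong e) t)
subst-cong e (app t u)   = cong₂ app (subst-cong e t) (subst-cong e u)

ext-∘ : ∀ (ρ ρ' : ℕ → ℕ) i → ext ρ (ext ρ' i) ≡ ext (ρ ∘ ρ') i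
ext-∘ ρ ρ' zero    = refl
ext-∘ ρ ρ' (suc i) = refl

rename-rename : ∀ (ρ ρ' : ℕ → ℕ) t → rename ρ (rename ρ' t) ≡ rename (ρ ∘ ρ') t
rename-rename ρ ρ' (var x)     = refl
rename-rename ρ ρ' (lam T t)   =
  cong (lam T) (trans (rename-rename (ext ρ) (ext ρ') t) (rename-cong (ext-∘ ρ ρ') t))
rename-rename ρ ρ' (delta T t) =
  cong (delta T) (trans (rename-rename (ext ρ) (ext ρ') t) (rename-cong (ext-∘ ρ ρ') t))
rename-rename ρ ρ' (app t u)   = cong₂ app (rename-rename ρ ρ' t) (rename-rename ρ ρ' u)

rename-square : ∀ {ρ ρ' τ τ' : ℕ → ℕ} → (∀ i → ρ (ρ' i) ≡ τ (τ' i)) →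
                ∀ t → rename ρ (rename ρ' t) ≡ rename τ (rename τ' t)
rename-square {ρ} {ρ'} {τ} {τ'} e t =
  trans (rename-rename ρ ρ' t) (trans (rename-cong e t) (sym (rename-rename τ τ' t)))

rename-weaken : ∀ (ρ : ℕ → ℕ) t → rename (ext ρ) (rename suc t) ≡ rename suc (rename ρ t)
rename-weaken ρ = rename-square (λ _ → refl)

exts-ext : ∀ σ (ρ : ℕ → ℕ) i → exts σ (ext ρ i) ≡ exts (σ ∘ ρ) i
exts-ext σ ρ zero    = refl
exts-ext σ ρ (suc i) = refl

ext-exts : ∀ (ρ : ℕ → ℕ) σ i → rename (ext ρ) (exts σ i) ≡ exts (rename ρ ∘ σ) i
ext-exts ρ σ zero    = refl
ext-exts ρ σ (suc i) = rename-weaken ρ (σ i)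

subst-rename : ∀ σ (ρ : ℕ → ℕ) t → subst σ (rename ρ t) ≡ subst (σ ∘ ρ) t
subst-rename σ ρ (var x)     = refl
subst-rename σ ρ (lam T t)   =
  cong (lam T) (trans (subst-rename (exts σ) (ext ρ) t) (subst-cong (exts-ext σ ρ) t))
subst-rename σ ρ (delta T t) =
  cong (delta T) (trans (subst-rename (exts σ) (ext ρ) t) (subst-cong (exts-ext σ ρ) t))
subst-rename σ ρ (app t u)   = cong₂ app (subst-rename σ ρ t) (subst-rename σ ρ u)

rename-subst : ∀ (ρ : ℕ → ℕ) σ t → rename ρ (subst σ t) ≡ subst (rename ρ ∘ σ) t
rename-subst ρ σ (var x)     = refl
rename-subst ρ σ (lam T t)   =
  cong (lam T) (trans (rename-subst (ext ρ) (exts σ) t) (subst-cong (ext-exts ρ σ) t))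
rename-subst ρ σ (delta T t) =
  cong (delta T) (trans (rename-subst (ext ρ) (exts σ) t) (subst-cong (ext-exts ρ σ) t))
rename-subst ρ σ (app t u)   = cong₂ app (rename-subst ρ σ t) (rename-subst ρ σ u)

subst-weaken : ∀ σ t → subst (exts σ) (rename suc t) ≡ rename suc (subst σ t)
subst-weaken σ t = trans (subst-rename (exts σ) suc t) (sym (rename-subst suc σ t))

exts-exts : ∀ σ τ i → subst (exts σ) (exts τ i) ≡ exts (subst σ ∘ τ) i
exts-exts σ τ zero    = refl
exts-exts σ τ (suc i) = subst-weaken σ (τ i)

subst-subst : ∀ σ τ t → subst σ (subst τ t) ≡ subst (subst σ ∘ τ) t
subst-subst σ τ (var x)     = refl
subst-subst σ τ (lam T t)   =
  cong (lam T) (trans (subst-subst (exts σ) (exts τ) t) (subst-cong (exts-exts σ τ) t))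
subst-subst σ τ (delta T t) =
  cong (delta T) (trans (subst-subst (exts σ) (exts τ) t) (subst-cong (exts-exts σ τ) t))
subst-subst σ τ (app t u)   = cong₂ app (subst-subst σ τ t) (subst-subst σ τ u)

ext-id : ∀ i → ext (λ j → j) i ≡ i
ext-id zero    = refl
ext-id (suc i) = refl

rename-id : ∀ t → rename (λ i → i) t ≡ t
rename-id (var x)     = refl
rename-id (lam T t)   = cong (lam T) (trans (rename-cong ext-id t) (rename-id t))
rename-id (delta T t) = cong (delta T) (trans (rename-cong ext-id t) (rename-id t))
rename-id (app t u)   = cong₂ app (rename-id t) (rename-id u)

exts-var : ∀ (ρ : ℕ → ℕ) i → exts (var ∘ ρ) i ≡ var (ext ρ i)
exts-var ρ zero    = refl
exts-var ρ (suc i) = refl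

subst-var : ∀ (ρ : ℕ → ℕ) t → subst (var ∘ ρ) t ≡ rename ρ t
subst-var ρ (var x)     = refl
subst-var ρ (lam T t)   = cong (lam T) (trans (subst-cong (exts-var ρ) t) (subst-var (ext ρ) t))
subst-var ρ (delta T t) = cong (delta T) (trans (subst-cong (exts-var ρ) t) (subst-var (ext ρ) t))
subst-var ρ (app t u)   = cong₂ app (subst-var ρ t) (subst-var ρ u)

subst-id : ∀ t → subst var t ≡ t
subst-id t = trans (subst-var (λ i → i) t) (rename-id t)

single-weaken : ∀ u t → rename suc t [ u ] ≡ t
single-weaken u t = trans (subst-rename (single u) suc t) (subst-id t)

inst-weaken : ∀ (ρ : ℕ → ℕ) u t → subst (inst ρ u) (rename suc t) ≡ rename ρ t
inst-weaken ρ u t = trans (subst-rename (inst ρ u) suc t) (subst-var ρ t)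

inst-self : ∀ t → subst (inst suc (var 0)) t ≡ t
inst-self t = trans (subst-cong inst-suc-0 t) (subst-id t)
  where inst-suc-0 : ∀ i → inst suc (var 0) i ≡ var i
        inst-suc-0 zero    = refl
        inst-suc-0 (suc i) = refl

β-inst : ∀ (ρ : ℕ → ℕ) u t → rename (ext ρ) t [ u ] ≡ subst (inst ρ u) t
β-inst ρ u t = trans (subst-rename (single u) (ext ρ) t) (subst-cong single-ext t)
  where single-ext : ∀ i → single u (ext ρ i) ≡ inst ρ u i
        single-ext zero    = refl
        single-ext (suc i) = refl

inst-exts : ∀ (ρ : ℕ → ℕ) u σ t →
            subst (inst ρ u) (subst (exts σ) t) ≡ subst (u ∷ₛ (rename ρ ∘ σ)) t
inst-exts ρ u σ t = trans (subst-subst (inst ρ u) (exts σ) t) (subst-cong inst-exts-pt t)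
  where inst-exts-pt : ∀ i → subst (inst ρ u) (exts σ i) ≡ (u ∷ₛ (rename ρ ∘ σ)) i
        inst-exts-pt zero    = refl
        inst-exts-pt (suc i) = inst-weaken ρ u (σ i)

-- The continuation λy. z (y u) that the structural rule substitutes for x
-- (z is variable 0, the binder of the new Δ).
structCont : Type → Term → Term
structCont T u = lam T (app (var 1) (app (var 0) (rename (λ i → suc (suc i)) u)))

rename-subst-commute : ∀ {ρ ρ' : ℕ → ℕ} {σ σ'} → (∀ i → rename ρ (σ i) ≡ σ' (ρ' i)) →
                       ∀ t → rename ρ (subst σ t) ≡ subst σ' (rename ρ' t)
rename-subst-commute {ρ} {ρ'} {σ} {σ'} e t =
  trans (rename-subst ρ σ t) (trans (subst-cong e t) (sym (subst-rename σ' ρ' t)))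

rename-step : ∀ (ρ : ℕ → ℕ) {t t'} → t ⟶ t' → rename ρ t ⟶ rename ρ t'
rename-step ρ (β {A} {t} {u}) =
  transport (app (lam A (rename (ext ρ) t)) (rename ρ u) ⟶_)
            (sym (rename-subst-commute single-pt t)) β
  where single-pt : ∀ i → rename ρ (single u i) ≡ single (rename ρ u) (ext ρ i)
        single-pt zero    = refl
        single-pt (suc i) = refl
rename-step ρ (struct {A} {B} {t} {u}) =
  transport (λ s → app (delta (¬' (A ⇒ B)) (rename (ext ρ) t)) (rename ρ u) ⟶ delta (¬' B) s)
            (sym (rename-subst-commute replace0-pt t)) struct
  where replace0-pt : ∀ i → rename (ext ρ) (replace0 (structCont (A ⇒ B) u) i)
                            ≡ replace0 (structCont (A ⇒ B) (rename ρ u)) (ext ρ i)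
        replace0-pt zero    =
          cong (λ w → lam (A ⇒ B) (app (var 1) (app (var 0) w))) (rename-square (λ _ → refl) u)
        replace0-pt (suc i) = refl
rename-step ρ (ξlam s)   = ξlam (rename-step (ext ρ) s)
rename-step ρ (ξdelta s) = ξdelta (rename-step (ext ρ) s)
rename-step ρ (ξappₗ s)  = ξappₗ (rename-step ρ s)
rename-step ρ (ξappᵣ s)  = ξappᵣ (rename-step ρ s)

rename-steps : ∀ (ρ : ℕ → ℕ) {t t'} → t ⟶* t' → rename ρ t ⟶* rename ρ t'
rename-steps ρ = gmap (rename ρ) (rename-step ρ)

Normal-rename : ∀ (ρ : ℕ → ℕ) {t} → Normal t → Normal (rename ρ t)
Head-rename   : ∀ (ρ : ℕ → ℕ) {t} → Head t → Head (rename ρ t)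
Normal-rename ρ (nvar x)     = nvar (ρ x)
Normal-rename ρ (nlam T n)   = nlam T (Normal-rename (ext ρ) n)
Normal-rename ρ (ndelta T n) = ndelta T (Normal-rename (ext ρ) n)
Normal-rename ρ (napp h n)   = napp (Head-rename ρ h) (Normal-rename ρ n)
Head-rename ρ (hvar x)   = hvar (ρ x)
Head-rename ρ (happ h n) = happ (Head-rename ρ h) (Normal-rename ρ n)

Head⇒Normal : ∀ {h} → Head h → Normal h
Head⇒Normal (hvar x)   = nvar x
Head⇒Normal (happ h n) = napp h n

WN : Term → Set
WN t = ∃ λ n → t ⟶! n

WN-rename : ∀ (ρ : ℕ → ℕ) {t} → WN t → WN (rename ρ t)
WN-rename ρ (n , r , nf) = rename ρ n , rename-steps ρ r , Normal-rename ρ nf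

WN-expand : ∀ {t t'} → t ⟶* t' → WN t' → WN t
WN-expand r (n , r' , nf) = n , r ◅◅ r' , nf

WN-lam : ∀ T {t} → WN t → WN (lam T t)
WN-lam T (n , r , nf) = lam T n , gmap (lam T) ξlam r , nlam T nf

WN-delta : ∀ T {t} → WN t → WN (delta T t)
WN-delta T (n , r , nf) = delta T n , gmap (delta T) ξdelta r , ndelta T nf

-- Reducibility, by recursion on the type.  The quantification over renamings
-- makes reducibility stable under weakening, which is needed under binders.
Red : Type → Term → Set
Red ⊥'       t = WN t
Red (base b) t = WN t
Red (A ⇒ B)  t = WN t × (∀ (ρ : ℕ → ℕ) u → Red A u → Red B (app (rename ρ t) u))

Red⇒WN : ∀ A {t} → Red A t → WN t
Red⇒WN ⊥'       r = r
Red⇒WN (base b) r = r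
Red⇒WN (A ⇒ B)  r = proj₁ r

Red-rename : ∀ A (ρ : ℕ → ℕ) {t} → Red A t → Red A (rename ρ t)
Red-rename ⊥'       ρ r = WN-rename ρ r
Red-rename (base b) ρ r = WN-rename ρ r
Red-rename (A ⇒ B)  ρ {t} (w , f) = WN-rename ρ w , λ ρ' u ru →
  transport (λ s → Red B (app s u)) (sym (rename-rename ρ' ρ t)) (f (ρ' ∘ ρ) u ru)

Red-expand : ∀ A {t t'} → t ⟶* t' → Red A t' → Red A t
Red-expand ⊥'       r w = WN-expand r w
Red-expand (base b) r w = WN-expand r w
Red-expand (A ⇒ B)  r (w , f) = WN-expand r w , λ ρ u ru →
  Red-expand B (gmap (λ s → app s u) ξappₗ (rename-steps ρ r)) (f ρ u ru)

-- A term reducing to a head normal form is reducible: applying it to a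
-- reducible (hence normalising) argument again yields a head normal form.
Red-neutral : ∀ A {t h} → t ⟶* h → Head h → Red A t
Red-neutral ⊥'       r hd = _ , r , Head⇒Normal hd
Red-neutral (base b) r hd = _ , r , Head⇒Normal hd
Red-neutral (A ⇒ B) {h = h} r hd = (_ , r , Head⇒Normal hd) , λ ρ u ru →
  let (n , ru' , nf) = Red⇒WN A ru in
  Red-neutral B (gmap (λ s → app s u) ξappₗ (rename-steps ρ r) ◅◅ gmap (app (rename ρ h)) ξappᵣ ru')
                (happ (Head-rename ρ hd) nf)

Red-var : ∀ A x → Red A (var x)
Red-var A x = Red-neutral A ε (hvar x)

Red-app : ∀ A B {t u} → Red (A ⇒ B) t → Red A u → Red B (app t u)
Red-app A B {t} {u} (_ , f) ru = transport (λ s → Red B (app s u)) (rename-id t) (f (λ i → i) u ru)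

RedBody : Type → Type → Term → Set
RedBody A B b = ∀ (ρ : ℕ → ℕ) u → Red A u → Red B (subst (inst ρ u) b)

-- Such a body is normalising: take the instance at its own bound variable.
RedBody⇒WN : ∀ A B {b} → RedBody A B b → WN b
RedBody⇒WN A B {b} H = transport WN (inst-self b) (Red⇒WN B (H suc (var 0) (Red-var A 0)))

Red-lam : ∀ A B {b} → RedBody A B b → Red (A ⇒ B) (lam A b)
Red-lam A B {b} H = WN-lam A (RedBody⇒WN A B H) , λ ρ u ru →
  Red-expand B (return β) (transport (Red B) (sym (β-inst ρ u b)) (H ρ u ru))

cont : Type → Term → Term → Term
cont T k w = lam T (app (rename suc k) (app (var 0) (rename suc w)))

structCont≡cont : ∀ T u → structCont T u ≡ cont T (var 0) (rename suc u)
structCont≡cont T u =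
  cong (λ w → lam T (app (var 1) (app (var 0) w))) (sym (rename-rename suc suc u))

rename-cont : ∀ (ρ : ℕ → ℕ) T k w → rename ρ (cont T k w) ≡ cont T (rename ρ k) (rename ρ w)
rename-cont ρ T k w =
  cong₂ (λ k' w' → lam T (app k' (app (var 0) w'))) (rename-weaken ρ k) (rename-weaken ρ w)

subst-cont : ∀ σ T k w → subst σ (cont T k w) ≡ cont T (subst σ k) (subst σ w)
subst-cont σ T k w =
  cong₂ (λ k' w' → lam T (app k' (app (var 0) w'))) (subst-weaken σ k) (subst-weaken σ w)

cont-β : ∀ T k w v → app (cont T k w) v ⟶ app k (app v w)
cont-β T k w v = transport (app (cont T k w) v ⟶_)
  (cong₂ (λ k' w' → app k' (app v w')) (single-weaken v k) (single-weaken v w)) β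

Red-cont : ∀ A B {k w} → Red (¬' B) k → Red A w → Red (¬' (A ⇒ B)) (cont (A ⇒ B) k w)
Red-cont A B {k} {w} rk rw = WN-lam (A ⇒ B) wn-body , λ ρ v rv →
  transport (λ c → WN (app c v)) (sym (rename-cont ρ (A ⇒ B) k w))
    (Red-expand ⊥' (return (cont-β (A ⇒ B) (rename ρ k) (rename ρ w) v))
      (Red-app B ⊥' (Red-rename (¬' B) ρ rk) (Red-app A B rv (Red-rename A ρ rw))))
  where
    wn-body : WN (app (rename suc k) (app (var 0) (rename suc w)))
    wn-body = Red-app B ⊥' (Red-rename (¬' B) suc rk)
                (Red-app A B (Red-var (A ⇒ B) 0) (Red-rename A suc rw))

-- Instances of the body produced by the structural rule: instantiating z by
-- k turns the substituted λy. z (y u) into cont k u.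
struct-inst : ∀ T (ρ ρ' : ℕ → ℕ) k u s →
  subst (inst ρ' k) (subst (replace0 (structCont T u)) (rename (ext ρ) s))
  ≡ subst (inst (ρ' ∘ ρ) (cont T k (rename ρ' u))) s
struct-inst T ρ ρ' k u s = begin
    subst (inst ρ' k) (subst (replace0 (structCont T u)) (rename (ext ρ) s))
  ≡⟨ cong (subst (inst ρ' k)) (subst-rename (replace0 (structCont T u)) (ext ρ) s) ⟩
    subst (inst ρ' k) (subst (replace0 (structCont T u) ∘ ext ρ) s)
  ≡⟨ subst-subst (inst ρ' k) (replace0 (structCont T u) ∘ ext ρ) s ⟩
    subst (subst (inst ρ' k) ∘ replace0 (structCont T u) ∘ ext ρ) s
  ≡⟨ subst-cong instance-pt s ⟩
    subst (inst (ρ' ∘ ρ) (cont T k (rename ρ' u))) s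
  ∎
  where
    open ≡-Reasoning
    instance-pt : ∀ i → subst (inst ρ' k) (replace0 (structCont T u) (ext ρ i))
                        ≡ inst (ρ' ∘ ρ) (cont T k (rename ρ' u)) i
    instance-pt zero    = begin
        subst (inst ρ' k) (structCont T u)
      ≡⟨ cong (subst (inst ρ' k)) (structCont≡cont T u) ⟩
        subst (inst ρ' k) (cont T (var 0) (rename suc u))
      ≡⟨ subst-cont (inst ρ' k) T (var 0) (rename suc u) ⟩
        cont T k (subst (inst ρ' k) (rename suc u))
      ≡⟨ cong (cont T k) (inst-weaken ρ' k u) ⟩
        cont T k (rename ρ' u)
      ∎
    instance-pt (suc i) = refl

-- A Δ-abstraction whose body is reducible at ⊥ under every reducible
-- instantiation of its bound variable is reducible.  At an arrow type,
-- apply the structural rule and recurse on the codomain.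
Red-Δ : ∀ A {s} → RedBody (¬' A) ⊥' s → Red A (delta (¬' A) s)
Red-Δ ⊥'       H = WN-delta (¬' ⊥') (RedBody⇒WN (¬' ⊥') ⊥' H)
Red-Δ (base b) H = WN-delta (¬' (base b)) (RedBody⇒WN (¬' (base b)) ⊥' H)
Red-Δ (A ⇒ B) {s} H = WN-delta (¬' (A ⇒ B)) (RedBody⇒WN (¬' (A ⇒ B)) ⊥' H) , λ ρ u ru →
  Red-expand B (return struct)
    (Red-Δ B {subst (replace0 (structCont (A ⇒ B) u)) (rename (ext ρ) s)}
      λ ρ' k rk →
        transport WN (sym (struct-inst (A ⇒ B) ρ ρ' k u s))
          (H (ρ' ∘ ρ) (cont (A ⇒ B) k (rename ρ' u))
             (Red-cont A B rk (Red-rename A ρ' ru))))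

RedSubst : Context → (ℕ → Term) → Set
RedSubst Γ σ = ∀ {x A} → Γ ∋ x ∶ A → Red A (σ x)

RedSubst-var : ∀ {Γ} → RedSubst Γ var
RedSubst-var {x = x} {A} _ = Red-var A x

RedSubst-rename : ∀ {Γ σ} (ρ : ℕ → ℕ) → RedSubst Γ σ → RedSubst Γ (rename ρ ∘ σ)
RedSubst-rename ρ hσ {A = A} p = Red-rename A ρ (hσ p)

RedSubst-extend : ∀ {Γ A σ u} → Red A u → RedSubst Γ σ → RedSubst (A ∷ Γ) (u ∷ₛ σ)
RedSubst-extend ru hσ here      = ru
RedSubst-extend ru hσ (there p) = hσ p

fundamental      : ∀ {Γ t T σ} → Γ ⊢ t ∶ T → RedSubst Γ σ → Red T (subst σ t)
fundamental-body : ∀ {Γ A B t σ} → (A ∷ Γ) ⊢ t ∶ B → RedSubst Γ σ →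
                   RedBody A B (subst (exts σ) t)
fundamental (ax p)                      hσ = hσ p
fundamental (⊢app {A = A} {B = B} d e)  hσ = Red-app A B (fundamental d hσ) (fundamental e hσ)
fundamental (⊢lam {A = A} {B = B} d)    hσ = Red-lam A B (fundamental-body d hσ)
fundamental (⊢delta {A = A} d)          hσ = Red-Δ A (fundamental-body d hσ)
fundamental-body {B = B} {t = t} {σ = σ} d hσ ρ u ru =
  transport (Red B) (sym (inst-exts ρ u σ t))
    (fundamental d (RedSubst-extend ru (RedSubst-rename ρ hσ)))

mainTheorem1 : ∀ (Γ : Context) (t : Term) (T : Type) → Γ ⊢ t ∶ T → ∃ λ n → t ⟶! n
mainTheorem1 Γ t T d =
  Red⇒WN T (transport (Red T) (subst-id t) (fundamental d RedSubst-var))
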